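{- There exists a set of $26$ vertices of $Q_7$ that percolates under the $4$-neighbour bootstrap process on $Q_7$.
   Context: $Q_d$ denotes the $d$-dimensional hypercube: vertex set $\{0,1\}^d$, two vertices adjacent iff they differ in exactly one coordinate. For $r\geq1$, the $r$-neighbour bootstrap process on a graph $G$ starts with a set $A_0\subseteq V(G)$ and sets $A_t:=A_{t-1}\cup\{v: |N_G(v)\cap A_{t-1}|\geq r\}$ for $t\geq1$; $A_0$ percolates if $\bigcup_t A_t=V(G)$. -}

module Defs where

open import Data.Bool using (Bool; true; false; not; _∨_; if_then_else_)
open import Data.Nat using (ℕ; zero; suc; _≤_; _≤ᵇ_)
open import Data.Fin using (Fin)
open import Data.Vec using (Vec; _[_]%=_; allFin; toList)
open import Data.List using (List; length; filter; map)
open import Data.List.Membership.Propositional using (_∈_)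
open import Data.List.Relation.Unary.Unique.Propositional using (Unique)
open import Data.Product using (∃; _×_)
open import Relation.Binary.PropositionalEquality using (_≡_)
open import Relation.Nullary.Decidable using (does)
open import Data.Bool using (_≟_)
open import Data.List.Relation.Unary.Any using (any?)
open import Data.Vec.Properties using (≡-dec)

Vertex : ℕ → Set
Vertex d = Vec Bool d

flip : ∀ {d} → Fin d → Vertex d → Vertex d
flip i v = v [ i ]%= not

neighbours : ∀ {d} → Vertex d → List (Vertex d)
neighbours {d} v = map (λ i → flip i v) (toList (allFin d))

VSet : ℕ → Set
VSet d = Vertex d → Bool

countIn : ∀ {d} → VSet d → Vertex d → ℕ
countIn A v = length (filter (λ u → A u ≟ true) (neighbours v))

step : ∀ {d} → ℕ → VSet d → VSet d
step r A v = A v ∨ (r ≤ᵇ countIn A v)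

bootstrap : ∀ {d} → ℕ → VSet d → ℕ → VSet d
bootstrap r A zero = A
bootstrap r A (suc t) = step r (bootstrap r A t)

Percolates : ∀ {d} → ℕ → VSet d → Set
Percolates {d} r A = (v : Vertex d) → ∃ λ t → bootstrap r A t v ≡ true

fromList : ∀ {d} → List (Vertex d) → VSet d
fromList xs v = does (any? (λ u → ≡-dec Data.Bool._≟_ u v) xs)

{-# OPTIONS --safe #-}
module Submission where

-- Percolation is certified by an infection schedule τ : V(Q_d) → ℕ in which
-- τ v = 0 only for initial vertices and every v with τ v = t + 1 has at least
-- r neighbours u with τ u ≤ t. By induction on t, every vertex with τ v ≤ t
-- lies in A_t. For the 26-set below such a schedule, with last infection at
-- time 25, is given explicitly and checked vertex by vertex.

open import Defs
open import Data.Bool using (Bool; true; false; T; _≟_)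
open import Data.Bool.Properties using (T?; T-≡; T-∨)
open import Data.Fin using (Fin; zero; suc; combine)
open import Data.Fin.Subset.Properties using (anySubset?)
open import Data.List using (List; []; _∷_; length)
import Data.List.Relation.Binary.Sublist.Propositional as Sublist
import Data.List.Relation.Binary.Sublist.Propositional.Properties as Sublist
open import Data.List.Relation.Unary.Unique.Propositional using (Unique)
open import Data.Nat using (ℕ; zero; suc; _≤_; _≤ᵇ_; _^_; z≤n; s≤s)
open import Data.Nat.Properties using (≤-refl; ≤-trans; ≤ᵇ⇒≤; ≤⇒≤ᵇ)
open import Data.Product using (∃; _×_; _,_)
open import Data.Sum using (inj₁; inj₂)
open import Data.Vec using (Vec; []; _∷_; lookup)
open import Data.Vec.Properties using (≡-dec)
open import Data.List.Relation.Unary.Unique.DecPropositional (≡-dec {n = 7} _≟_) using (unique?)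
open import Function using (_∘_; Equivalence)
open import Level using (Level)
open import Relation.Binary.PropositionalEquality using (_≡_; refl; subst; sym)
open import Relation.Nullary using (Dec; ¬?; map′; from-yes)
open import Relation.Nullary.Decidable using (decidable-stable)
open import Relation.Unary using (Pred; Decidable)

open Equivalence using (to; from)

private
  variable
    d r : ℕ
    A B : VSet d
    p : Level

-- Vertex d is Subset d (true = inside), so anySubset? searches the whole cube.
all-vertices? : {P : Pred (Vertex d) p} → Decidable P → Dec (∀ v → P v)
all-vertices? P? =
  map′ (λ noCounterexample v → decidable-stable (P? v) (λ ¬Pv → noCounterexample (v , ¬Pv)))
       (λ ∀P (v , ¬Pv) → ¬Pv (∀P v))
       (¬? (anySubset? (¬? ∘ P?)))

_⊆_ : VSet d → VSet d → Set
A ⊆ B = ∀ {v} → T (A v) → T (B v)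

countIn-mono : A ⊆ B → ∀ v → countIn A v ≤ countIn B v
countIn-mono {A = A} {B = B} A⊆B v =
  Sublist.length-mono-≤
    (Sublist.filter⁺ (λ u → A u ≟ true) (λ u → B u ≟ true)
                     (λ { refl → to T-≡ ∘ A⊆B ∘ from T-≡ })
                     (Sublist.⊆-refl {x = neighbours v}))

⊆-step : ∀ {r} {A : VSet d} → A ⊆ step r A
⊆-step = from T-∨ ∘ inj₁

step-threshold : ∀ {r} {A : VSet d} {v} → r ≤ countIn A v → T (step r A v)
step-threshold = from T-∨ ∘ inj₂ ∘ ≤⇒≤ᵇ

infectedBy : (Vertex d → ℕ) → ℕ → VSet d
infectedBy τ t u = τ u ≤ᵇ t

justified : ℕ → VSet d → (Vertex d → ℕ) → Vertex d → ℕ → Bool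
justified r A τ v zero    = A v
justified r A τ v (suc t) = r ≤ᵇ countIn (infectedBy τ t) v

IsSchedule : ℕ → VSet d → (Vertex d → ℕ) → Set
IsSchedule r A τ = ∀ v → T (justified r A τ v (τ v))

isSchedule? : ∀ r (A : VSet d) τ → Dec (IsSchedule r A τ)
isSchedule? r A τ = all-vertices? (λ v → T? (justified r A τ v (τ v)))

scheduled⇒infected : ∀ τ → IsSchedule r A τ → ∀ t {u} → τ u ≤ t → T (bootstrap r A t u)
scheduled⇒infected {r = r} {A = A} τ schedule = go
  where
  go : ∀ t {u} → τ u ≤ t → T (bootstrap r A t u)
  go t {u} τu≤t with τ u in τu≡ | schedule u
  go zero    _ | zero | initial = initial
  go (suc t) _ | zero | _ =
    ⊆-step {r = r} {A = bootstrap r A t} (go t (subst (_≤ t) (sym τu≡) z≤n))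
  go (suc t) {u} (s≤s s≤t) | suc s | enough =
    step-threshold {r = r} {A = bootstrap r A t}
      (≤-trans (≤ᵇ⇒≤ _ _ enough) (countIn-mono earlier u))
    where
    earlier : infectedBy τ s ⊆ bootstrap r A t
    earlier τw≤s = go t (≤-trans (≤ᵇ⇒≤ _ _ τw≤s) s≤t)

schedule⇒percolates : ∀ τ → IsSchedule r A τ → Percolates r A
schedule⇒percolates τ schedule v = τ v , to T-≡ (scheduled⇒infected τ schedule (τ v) ≤-refl)

bit : Bool → Fin 2
bit false = zero
bit true  = suc zero

index : Vertex d → Fin (2 ^ d)
index []      = zero
index (b ∷ v) = combine (bit b) (index v)

initialSet : List (Vertex 7)
initialSet =
  (false ∷ false ∷ false ∷ false ∷ false ∷ false ∷ false ∷ []) ∷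
  (false ∷ false ∷ false ∷ false ∷ false ∷ true ∷ true ∷ []) ∷
  (false ∷ false ∷ false ∷ false ∷ true ∷ true ∷ false ∷ []) ∷
  (false ∷ false ∷ false ∷ true ∷ false ∷ true ∷ false ∷ []) ∷
  (false ∷ false ∷ true ∷ false ∷ true ∷ true ∷ true ∷ []) ∷
  (false ∷ true ∷ false ∷ false ∷ true ∷ false ∷ true ∷ []) ∷
  (false ∷ true ∷ false ∷ true ∷ false ∷ true ∷ true ∷ []) ∷
  (false ∷ true ∷ true ∷ false ∷ false ∷ true ∷ true ∷ []) ∷
  (false ∷ true ∷ true ∷ false ∷ true ∷ false ∷ false ∷ []) ∷
  (false ∷ true ∷ true ∷ true ∷ true ∷ false ∷ true ∷ []) ∷
  (false ∷ true ∷ true ∷ true ∷ true ∷ true ∷ false ∷ []) ∷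
  (true ∷ false ∷ false ∷ false ∷ true ∷ false ∷ false ∷ []) ∷
  (true ∷ false ∷ false ∷ true ∷ false ∷ false ∷ false ∷ []) ∷
  (true ∷ false ∷ false ∷ true ∷ false ∷ true ∷ true ∷ []) ∷
  (true ∷ false ∷ false ∷ true ∷ true ∷ false ∷ true ∷ []) ∷
  (true ∷ false ∷ true ∷ false ∷ false ∷ false ∷ false ∷ []) ∷
  (true ∷ false ∷ true ∷ false ∷ false ∷ true ∷ true ∷ []) ∷
  (true ∷ false ∷ true ∷ false ∷ true ∷ true ∷ false ∷ []) ∷
  (true ∷ false ∷ true ∷ true ∷ false ∷ false ∷ true ∷ []) ∷
  (true ∷ false ∷ true ∷ true ∷ true ∷ true ∷ true ∷ []) ∷
  (true ∷ true ∷ false ∷ false ∷ false ∷ false ∷ true ∷ []) ∷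
  (true ∷ true ∷ false ∷ false ∷ false ∷ true ∷ false ∷ []) ∷
  (true ∷ true ∷ false ∷ false ∷ true ∷ true ∷ true ∷ []) ∷
  (true ∷ true ∷ false ∷ true ∷ true ∷ true ∷ false ∷ []) ∷
  (true ∷ true ∷ true ∷ false ∷ false ∷ false ∷ true ∷ []) ∷
  (true ∷ true ∷ true ∷ true ∷ false ∷ true ∷ false ∷ []) ∷
  []

-- Entry i is the infection time of the vertex whose coordinates, read as
-- bits with the first one most significant, spell i.
infectionTimes : Vec ℕ (2 ^ 7)
infectionTimes =
  0 ∷ 23 ∷ 1 ∷ 0 ∷ 21 ∷ 22 ∷ 0 ∷ 7 ∷ 23 ∷ 24 ∷ 0 ∷ 1 ∷ 22 ∷ 23 ∷ 17 ∷ 16 ∷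
  23 ∷ 24 ∷ 16 ∷ 1 ∷ 22 ∷ 23 ∷ 15 ∷ 0 ∷ 24 ∷ 25 ∷ 17 ∷ 16 ∷ 23 ∷ 24 ∷ 18 ∷ 17 ∷
  21 ∷ 22 ∷ 16 ∷ 5 ∷ 20 ∷ 0 ∷ 15 ∷ 8 ∷ 22 ∷ 23 ∷ 17 ∷ 0 ∷ 21 ∷ 20 ∷ 16 ∷ 15 ∷
  22 ∷ 23 ∷ 17 ∷ 0 ∷ 0 ∷ 14 ∷ 14 ∷ 13 ∷ 23 ∷ 24 ∷ 18 ∷ 15 ∷ 20 ∷ 0 ∷ 0 ∷ 14 ∷
  1 ∷ 2 ∷ 4 ∷ 3 ∷ 0 ∷ 7 ∷ 5 ∷ 6 ∷ 0 ∷ 1 ∷ 5 ∷ 0 ∷ 9 ∷ 0 ∷ 8 ∷ 7 ∷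
  0 ∷ 1 ∷ 5 ∷ 0 ∷ 17 ∷ 16 ∷ 0 ∷ 1 ∷ 7 ∷ 0 ∷ 6 ∷ 1 ∷ 18 ∷ 17 ∷ 9 ∷ 0 ∷
  20 ∷ 0 ∷ 0 ∷ 4 ∷ 19 ∷ 8 ∷ 6 ∷ 0 ∷ 21 ∷ 20 ∷ 6 ∷ 7 ∷ 20 ∷ 19 ∷ 0 ∷ 8 ∷
  19 ∷ 0 ∷ 6 ∷ 5 ∷ 18 ∷ 15 ∷ 11 ∷ 12 ∷ 20 ∷ 19 ∷ 0 ∷ 8 ∷ 19 ∷ 18 ∷ 10 ∷ 11 ∷
  []

infectionTime : Vertex 7 → ℕ
infectionTime v = lookup infectionTimes (index v)

lemma4p4 : ∃ λ (A : List (Vertex 7)) →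
             Unique A × length A ≡ 26 × Percolates 4 (fromList A)
lemma4p4 =
  initialSet ,
  from-yes (unique? initialSet) ,
  refl ,
  schedule⇒percolates infectionTime (from-yes (isSchedule? 4 (fromList initialSet) infectionTime))
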